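{- If the support of a distribution $\mu$ on $\Sigma_1\times\dots\times\Sigma_k$ (finite alphabets) has no Abelian embedding, then the marginal of $\mu$ on any $k-1$ of the coordinates also has no Abelian embedding.
   Context: A distribution on a product of finite alphabets $\Sigma_{i}$ (indexed by some set $T$) admits an Abelian embedding if there exist an Abelian group $G$ and maps $\sigma_i:\Sigma_i\to G$ ($i\in T$), not all constant, with $\sum_{i\in T}\sigma_i(a_i)=0_G$ for every $(a_i)_{i\in T}$ in its support. -}

module Defs where

open import Level using (Level; _⊔_) renaming (suc to lsuc; zero to lzero)
open import Data.Nat using (ℕ; zero; suc)
open import Data.Fin using (Fin; zero; suc; punchIn)
open import Data.Product using (Σ; ∃; _×_; _,_)
open import Relation.Binary.PropositionalEquality using (_≡_)
open import Relation.Nullary using (¬_)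
open import Algebra.Bundles using (AbelianGroup)

-- A point of the product alphabet Σ_1 × ... × Σ_m, where the i-th finite
-- alphabet is Fin (n i).
Tuple : (m : ℕ) → (n : Fin m → ℕ) → Set
Tuple m n = (i : Fin m) → Fin (n i)

-- A subset of the product alphabet (e.g. the support of a distribution).
Subset : (m : ℕ) → (n : Fin m → ℕ) → Set₁
Subset m n = Tuple m n → Set

module _ {c ℓ : Level} (G : AbelianGroup c ℓ) where
  open AbelianGroup G

  ∑ : (m : ℕ) → (Fin m → Carrier) → Carrier
  ∑ zero    f = ε
  ∑ (suc m) f = f zero ∙ ∑ m (λ i → f (suc i))

IsConstant : {c ℓ : Level} (G : AbelianGroup c ℓ) {A : Set} →
             (A → AbelianGroup.Carrier G) → Set ℓ
IsConstant G {A} σ = (a b : A) → AbelianGroup._≈_ G (σ a) (σ b)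

AbelianEmbeddingInto : {c ℓ : Level} (G : AbelianGroup c ℓ) →
                       (m : ℕ) (n : Fin m → ℕ) → Subset m n → Set (c ⊔ ℓ)
AbelianEmbeddingInto G m n S =
  Σ ((i : Fin m) → Fin (n i) → AbelianGroup.Carrier G) λ σ →
    (¬ ((i : Fin m) → IsConstant G (σ i))) ×
    ((x : Tuple m n) → S x →
       AbelianGroup._≈_ G (∑ G m (λ i → σ i (x i))) (AbelianGroup.ε G))

HasAbelianEmbedding : (c ℓ : Level) (m : ℕ) (n : Fin m → ℕ) →
                      Subset m n → Set (lsuc (c ⊔ ℓ))
HasAbelianEmbedding c ℓ m n S =
  Σ (AbelianGroup c ℓ) λ G → AbelianEmbeddingInto G m n S

-- Support of the marginal on all coordinates except j: the projection of S
-- forgetting coordinate j (coordinate i of the marginal is coordinate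
-- punchIn j i of the original).
Marginal : (m : ℕ) (n : Fin (suc m) → ℕ) (j : Fin (suc m)) →
           Subset (suc m) n → Subset m (λ i → n (punchIn j i))
Marginal m n j S y =
  ∃ λ (x : Tuple (suc m) n) → S x × ((i : Fin m) → x (punchIn j i) ≡ y i)

module Submission where

open import Defs
open import Level using (Level)
open import Data.Nat using (ℕ; zero; suc)
open import Data.Fin using (Fin; punchIn; zero; suc)
open import Data.Product using (_,_)
open import Function using (_∘_)
open import Relation.Nullary using (¬_)
open import Relation.Binary.PropositionalEquality as ≡ using (_≡_)
open import Algebra.Bundles using (AbelianGroup)

-- An Abelian embedding of the marginal becomes one of S by mapping the
-- forgotten coordinate j to 0: the sums are unchanged, and the maps on the
-- other coordinates are untouched, so they are still not all constant.

module _ {c ℓ : Level} (G : AbelianGroup c ℓ) where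
  open AbelianGroup G

  ∑-cong : (m : ℕ) {f g : Fin m → Carrier} → (∀ i → f i ≈ g i) → ∑ G m f ≈ ∑ G m g
  ∑-cong zero    f≈g = refl
  ∑-cong (suc m) f≈g = ∙-cong (f≈g zero) (∑-cong m (f≈g ∘ suc))

  ∑-punchIn : (m : ℕ) (j : Fin (suc m)) (f : Fin (suc m) → Carrier) →
              f j ≈ ε → ∑ G (suc m) f ≈ ∑ G m (f ∘ punchIn j)
  ∑-punchIn m       zero    f fj≈ε = trans (∙-congʳ fj≈ε) (identityˡ _)
  ∑-punchIn (suc m) (suc j) f fj≈ε = ∙-congˡ (∑-punchIn m j (f ∘ suc) fj≈ε)

  extendByZero : (m : ℕ) (n : Fin (suc m) → ℕ) (j : Fin (suc m)) →
                 ((i : Fin m) → Fin (n (punchIn j i)) → Carrier) →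
                 (k : Fin (suc m)) → Fin (n k) → Carrier
  extendByZero m       n zero    τ zero    a = ε
  extendByZero m       n zero    τ (suc k) a = τ k a
  extendByZero (suc m) n (suc j) τ zero    a = τ zero a
  extendByZero (suc m) n (suc j) τ (suc k) a = extendByZero m (n ∘ suc) j (τ ∘ suc) k a

  extendByZero-at : (m : ℕ) (n : Fin (suc m) → ℕ) (j : Fin (suc m))
                    (τ : (i : Fin m) → Fin (n (punchIn j i)) → Carrier) (a : Fin (n j)) →
                    extendByZero m n j τ j a ≡ ε
  extendByZero-at m       n zero    τ a = ≡.refl
  extendByZero-at (suc m) n (suc j) τ a = extendByZero-at m (n ∘ suc) j (τ ∘ suc) a

  extendByZero-punchIn : (m : ℕ) (n : Fin (suc m) → ℕ) (j : Fin (suc m))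
                         (τ : (i : Fin m) → Fin (n (punchIn j i)) → Carrier)
                         (i : Fin m) (a : Fin (n (punchIn j i))) →
                         extendByZero m n j τ (punchIn j i) a ≡ τ i a
  extendByZero-punchIn m       n zero    τ i       a = ≡.refl
  extendByZero-punchIn (suc m) n (suc j) τ zero    a = ≡.refl
  extendByZero-punchIn (suc m) n (suc j) τ (suc i) a =
    extendByZero-punchIn m (n ∘ suc) j (τ ∘ suc) i a

  abelianEmbeddingInto-fromMarginal :
    (m : ℕ) (n : Fin (suc m) → ℕ) (S : Subset (suc m) n) (j : Fin (suc m)) →
    AbelianEmbeddingInto G m (n ∘ punchIn j) (Marginal m n j S) →
    AbelianEmbeddingInto G (suc m) n S
  abelianEmbeddingInto-fromMarginal m n S j (τ , τ-nonconstant , τ-vanishes) =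
    σ , σ-nonconstant , σ-vanishes
    where
    σ : (k : Fin (suc m)) → Fin (n k) → Carrier
    σ = extendByZero m n j τ

    σ-nonconstant : ¬ ((k : Fin (suc m)) → IsConstant G (σ k))
    σ-nonconstant σ-constant = τ-nonconstant λ i a b →
      ≡.subst₂ _≈_ (extendByZero-punchIn m n j τ i a) (extendByZero-punchIn m n j τ i b)
        (σ-constant (punchIn j i) a b)

    σ-vanishes : (x : Tuple (suc m) n) → S x → ∑ G (suc m) (λ k → σ k (x k)) ≈ ε
    σ-vanishes x x∈S = begin
      ∑ G (suc m) (λ k → σ k (x k))
        ≈⟨ ∑-punchIn m j (λ k → σ k (x k)) (reflexive (extendByZero-at m n j τ (x j))) ⟩
      ∑ G m (λ i → σ (punchIn j i) (x (punchIn j i)))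
        ≈⟨ ∑-cong m (λ i → reflexive (extendByZero-punchIn m n j τ i (x (punchIn j i)))) ⟩
      ∑ G m (λ i → τ i (x (punchIn j i)))
        ≈⟨ τ-vanishes (x ∘ punchIn j) (x , x∈S , λ i → ≡.refl) ⟩
      ε ∎
      where open import Relation.Binary.Reasoning.Setoid setoid

mainTheorem6 : {c ℓ : Level} (m : ℕ) (n : Fin (suc m) → ℕ) (S : Subset (suc m) n) (j : Fin (suc m)) →
    ¬ HasAbelianEmbedding c ℓ (suc m) n S →
    ¬ HasAbelianEmbedding c ℓ m (λ i → n (punchIn j i)) (Marginal m n j S)
mainTheorem6 m n S j noEmbedding (G , embedding) =
  noEmbedding (G , abelianEmbeddingInto-fromMarginal G m n S j embedding)
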